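{- In any $B_1$-EPG representation of a graph $G$, a set of paths forming two different claws of the grid centered at the same grid point contains four paths forming either a true pie or a false pie. Consequently, in any $B_1$-EPG representation of a chordal graph $G$, no two maximal cliques of $G$ that are claw-cliques are represented on claws centered at the same grid point.
   Context: All graphs are finite and simple; a graph is chordal if it has no induced cycle of length at least $4$. An EPG representation of $G$ assigns to each vertex $v$ a path $P_v$ in the rectangular grid such that two distinct vertices are adjacent iff their paths share at least one grid edge; it is $B_1$-EPG if every path has at most one bend. A claw of the grid is a set of three grid edges incident to a common grid point (its center). A set of paths forms a claw if each pair of edges of the claw is covered by (i.e. contained in) some path of the set. In a $B_1$-EPG representation, a clique $K$ is a claw-clique if the paths of $K$ do not share a common grid edge; then there is a unique claw of the grid such that each path of a vertex of $K$ contains exactly two of its three edges, and $K$ is said to be represented on (centered at the center of) that claw. Given a grid point $b$ with its four incident grid edges (a $4$-star), four paths $P_1,\dots,P_4$, each containing a different pair of edges of the $4$-star, form a true pie if each of them bends at $b$, and a false pie if exactly two of them bend at $b$ and these two do not share an edge of the $4$-star. -}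

module Defs where

open import Data.Nat using (ℕ; suc; _%_)
open import Data.Integer using (ℤ; _+_; _-_; 1ℤ)
open import Data.Fin using (Fin; toℕ)
open import Data.Fin.Subset using (Subset; _∈_)
open import Data.Product using (Σ; ∃; ∃-syntax; _×_; _,_)
open import Data.Sum using (_⊎_)
open import Data.List using (List; _∷_; [])
open import Data.List.Relation.Unary.Unique.Propositional using (Unique)
open import Relation.Nullary using (¬_)
open import Relation.Binary.PropositionalEquality using (_≡_; _≢_)
open import Function.Bundles using (_⇔_)
open import Function.Definitions using (Injective)

record SimpleGraph (n : ℕ) : Set₁ where
  field
    Adj   : Fin n → Fin n → Set
    sym   : ∀ {u v} → Adj u v → Adj v u
    irrefl : ∀ {u} → ¬ Adj u u
open SimpleGraph public

CycAdj : (m : ℕ) → Fin (4 Data.Nat.+ m) → Fin (4 Data.Nat.+ m) → Set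
CycAdj m i j = (suc (toℕ i) % (4 Data.Nat.+ m) ≡ toℕ j)
             ⊎ (suc (toℕ j) % (4 Data.Nat.+ m) ≡ toℕ i)

InducedCycle : ∀ {n} → SimpleGraph n → (m : ℕ) → Set
InducedCycle {n} G m =
  Σ (Fin (4 Data.Nat.+ m) → Fin n) λ c →
    Injective _≡_ _≡_ c × (∀ i j → Adj G (c i) (c j) ⇔ CycAdj m i j)

Chordal : ∀ {n} → SimpleGraph n → Set
Chordal G = ∀ m → ¬ InducedCycle G m

Clique : ∀ {n} → SimpleGraph n → Subset n → Set
Clique G K = ∀ u v → u ∈ K → v ∈ K → u ≢ v → Adj G u v

MaximalClique : ∀ {n} → SimpleGraph n → Subset n → Set
MaximalClique G K =
  Clique G K × (∀ v → (∀ u → u ∈ K → u ≢ v → Adj G u v) → v ∈ K)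

Point : Set
Point = ℤ × ℤ

data Dir : Set where
  N E S W : Dir

step : Point → Dir → Point
step (x , y) N = (x , y + 1ℤ)
step (x , y) E = (x + 1ℤ , y)
step (x , y) S = (x , y - 1ℤ)
step (x , y) W = (x - 1ℤ , y)

data Consec : List Point → Point → Point → Set where
  here  : ∀ {p q ps} → Consec (p ∷ q ∷ ps) p q
  there : ∀ {r ps p q} → Consec ps p q → Consec (r ∷ ps) p q

data Consec3 : List Point → Point → Point → Point → Set where
  here  : ∀ {p q r ps} → Consec3 (p ∷ q ∷ r ∷ ps) p q r
  there : ∀ {s ps p q r} → Consec3 ps p q r → Consec3 (s ∷ ps) p q r

data NonTrivial : List Point → Set where
  nt : ∀ {p q ps} → NonTrivial (p ∷ q ∷ ps)

IsGridPath : List Point → Set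
IsGridPath P =
  NonTrivial P × Unique P × (∀ p q → Consec P p q → ∃[ d ] q ≡ step p d)

ContainsEdge : List Point → Point → Point → Set
ContainsEdge P p q = Consec P p q ⊎ Consec P q p

BendsAt : List Point → Point → Set
BendsAt P b = ∃[ a ] ∃[ c ] ∃[ d₁ ] ∃[ d₂ ]
  (Consec3 P a b c × b ≡ step a d₁ × c ≡ step b d₂ × d₁ ≢ d₂)

AtMostOneBend : List Point → Set
AtMostOneBend P = ∀ b b′ → BendsAt P b → BendsAt P b′ → b ≡ b′

SharesEdge : List Point → List Point → Set
SharesEdge P Q = ∃[ p ] ∃[ q ] (ContainsEdge P p q × ContainsEdge Q p q)

record B1EPG {n : ℕ} (G : SimpleGraph n) : Set where
  field
    path     : Fin n → List Point
    isPath   : ∀ v → IsGridPath (path v)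
    oneBend  : ∀ v → AtMostOneBend (path v)
    edgeRep  : ∀ u v → u ≢ v → (Adj G u v ⇔ SharesEdge (path u) (path v))
open B1EPG public

CoversStar : List Point → Point → Dir → Set
CoversStar P b d = ContainsEdge P b (step b d)

-- A claw of the grid: the three edges incident to `center` in
-- directions other than `omit` (every claw of the grid is of this form,
-- uniquely).
record Claw : Set where
  constructor claw
  field
    center : Point
    omit   : Dir
open Claw public

FormsClaw : ∀ {n} → (Fin n → List Point) → Subset n → Claw → Set
FormsClaw P A (claw b o) =
  ∀ d d′ → d ≢ o → d′ ≢ o → d ≢ d′ →
    ∃[ v ] (v ∈ A × CoversStar (P v) b d × CoversStar (P v) b d′)

SamePair : Dir × Dir → Dir × Dir → Set
SamePair (a , b) (c , d) = (a ≡ c × b ≡ d) ⊎ (a ≡ d × b ≡ c)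

PieConfig : ∀ {n} → (Fin n → List Point) → Subset n → Point →
            (Fin 4 → Fin n) → (Fin 4 → Dir × Dir) → Set
PieConfig P A b v pr =
  (∀ i → v i ∈ A) ×
  (∀ i → let (d , d′) = pr i in
           d ≢ d′ × CoversStar (P (v i)) b d × CoversStar (P (v i)) b d′) ×
  (∀ i j → i ≢ j → ¬ SamePair (pr i) (pr j))

TruePie : ∀ {n} → (Fin n → List Point) → Subset n → Point → Set
TruePie P A b = ∃[ v ] ∃[ pr ]
  (PieConfig P A b v pr × (∀ i → BendsAt (P (v i)) b))

FalsePie : ∀ {n} → (Fin n → List Point) → Subset n → Point → Set
FalsePie P A b = ∃[ v ] ∃[ pr ] ∃[ i ] ∃[ j ]
  (PieConfig P A b v pr × i ≢ j ×
   BendsAt (P (v i)) b × BendsAt (P (v j)) b ×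
   (∀ k → BendsAt (P (v k)) b → k ≡ i ⊎ k ≡ j) ×
   ¬ (∃[ d ] (CoversStar (P (v i)) b d × CoversStar (P (v j)) b d)))

CommonEdge : ∀ {n} → (Fin n → List Point) → Subset n → Set
CommonEdge P K = ∃[ p ] ∃[ d ] (∀ v → v ∈ K → ContainsEdge (P v) p (step p d))

RepresentedOn : ∀ {n} {G : SimpleGraph n} → B1EPG G → Subset n → Claw → Set
RepresentedOn {G = G} R K (claw b o) =
  Clique G K × ¬ CommonEdge (path R) K ×
  (∀ v → v ∈ K → ∃[ d ] ∃[ d′ ]
     (d ≢ o × d′ ≢ o × d ≢ d′ ×
      CoversStar (path R v) b d × CoversStar (path R v) b d′ ×
      (∀ d″ → d″ ≢ o → CoversStar (path R v) b d″ → d″ ≡ d ⊎ d″ ≡ d′)))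

-- A simple grid path containing two edges of the 4-star at b passes through b along them, so it
-- bends at b exactly when the two edges are perpendicular; having at most one bend, it then lies
-- on the two rays from b along these edges.
-- Two claws centred at b omit different star edges o₁ ≠ o₂ and together cover every pair of star
-- edges avoiding o₁ or avoiding o₂. If o₁ and o₂ are opposite, these include the four
-- perpendicular pairs (a true pie); otherwise they include the two straight pairs and the two
-- perpendicular pairs avoiding o₁ and o₂ respectively (a false pie).
-- In either pie consecutive paths share a star edge, two opposite bent paths meet only at b, and
-- two crossing straight paths meet only at b and at one point not adjacent to b; so the four
-- vertices induce a 4-cycle. Hence in a chordal graph two claw-cliques centred at the same point
-- lie on the same claw (the paths of a claw-clique form its claw, for otherwise they would all
-- contain its third edge). Any two paths on one claw share one of its three edges, so by
-- maximality each of the two cliques contains the other.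

module Submission where

open import Defs hiding (sym)
open import Data.Empty using (⊥; ⊥-elim)
open import Data.Fin using (Fin; zero; suc; toℕ)
import Data.Fin.Properties as Fin
open import Data.Fin.Subset using (Subset; _∈_; _⊆_)
open import Data.Fin.Subset.Properties using (_∈?_; ⊆-antisym)
import Data.Nat as ℕ
open import Data.Integer using (ℤ; _+_; _-_; -_; 0ℤ; 1ℤ; _≤_)
import Data.Integer.Properties as ℤ
open import Algebra.Properties.AbelianGroup ℤ.+-0-abelianGroup using (∙-cancelˡ; identityʳ-unique)
open import Data.List using (List; []; _∷_; _++_; [_])
open import Data.List.Membership.Propositional using () renaming (_∈_ to _∈ₗ_)
open import Data.List.Membership.Propositional.Properties using (∈-++⁺ˡ; ∈-++⁺ʳ; ∈-++⁻)
open import Data.List.Properties using (++-assoc)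
import Data.List.Relation.Unary.All as All
open import Data.List.Relation.Unary.AllPairs using (_∷_)
open import Data.List.Relation.Unary.Any using (here; there)
open import Data.List.Relation.Unary.Unique.Propositional using (Unique)
open import Data.List.Relation.Unary.Unique.Propositional.Properties using (Unique[x∷xs]⇒x∉xs)
open import Data.Product using (Σ; ∃; ∃₂; ∃-syntax; _×_; _,_; proj₁; proj₂)
open import Data.Sum using (_⊎_; inj₁; inj₂; [_,_]′; map₁; map₂; swap)
open import Data.Unit using (⊤; tt)
open import Data.Vec using (lookup; _∷_; [])
open import Function using (id; _∘_)
open import Function.Bundles using (_⇔_; mk⇔; Equivalence)
open import Relation.Binary.Definitions using (DecidableEquality)
open import Relation.Binary.PropositionalEquality hiding ([_])
open import Relation.Nullary using (¬_; Dec; yes; no)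
open import Relation.Nullary.Decidable
  using (True; False; toWitness; toWitnessFalse; from-yes; map′; ¬?; _×-dec_; _⊎-dec_; _→-dec_)

-- Directions

_≟_ : DecidableEquality Dir
N ≟ N = yes refl
N ≟ E = no λ ()
N ≟ S = no λ ()
N ≟ W = no λ ()
E ≟ N = no λ ()
E ≟ E = yes refl
E ≟ S = no λ ()
E ≟ W = no λ ()
S ≟ N = no λ ()
S ≟ E = no λ ()
S ≟ S = yes refl
S ≟ W = no λ ()
W ≟ N = no λ ()
W ≟ E = no λ ()
W ≟ S = no λ ()
W ≟ W = yes refl

_≢?_ : (d d′ : Dir) → Dec (d ≢ d′)
d ≢? d′ = ¬? (d ≟ d′)

all? : {P : Dir → Set} → (∀ d → Dec (P d)) → Dec (∀ d → P d)
all? P? = map′ (λ { (n , e , s , w) → λ { N → n ; E → e ; S → s ; W → w } })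
               (λ p → p N , p E , p S , p W)
               (P? N ×-dec P? E ×-dec P? S ×-dec P? W)

any? : {P : Dir → Set} → (∀ d → Dec (P d)) → Dec (∃ P)
any? P? = map′
  (λ { (inj₁ p) → N , p ; (inj₂ (inj₁ p)) → E , p
      ; (inj₂ (inj₂ (inj₁ p))) → S , p ; (inj₂ (inj₂ (inj₂ p))) → W , p })
  (λ { (N , p) → inj₁ p ; (E , p) → inj₂ (inj₁ p)
      ; (S , p) → inj₂ (inj₂ (inj₁ p)) ; (W , p) → inj₂ (inj₂ (inj₂ p)) })
  (P? N ⊎-dec P? E ⊎-dec P? S ⊎-dec P? W)

opp rot : Dir → Dir
opp N = S
opp E = W
opp S = N
opp W = E
rot N = E
rot E = S
rot S = W
rot W = N

opp-involutive : ∀ d → opp (opp d) ≡ d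
opp-involutive = from-yes (all? λ d → opp (opp d) ≟ d)

Perpendicular : Dir → Dir → Set
Perpendicular d d′ = d′ ≢ d × d′ ≢ opp d

perpendicular? : ∀ d d′ → Dec (Perpendicular d d′)
perpendicular? d d′ = d′ ≢? d ×-dec d′ ≢? opp d

perpendicular-opposites : ∀ d d′ → Perpendicular d d′ →
  Perpendicular (opp d) (opp d′) × opp d ≢ d × opp d ≢ d′ × opp d′ ≢ d × opp d′ ≢ d′
perpendicular-opposites = from-yes
  (all? λ d → all? λ d′ → perpendicular? d d′ →-dec
    (perpendicular? (opp d) (opp d′) ×-dec
      opp d ≢? d ×-dec opp d ≢? d′ ×-dec opp d′ ≢? d ×-dec opp d′ ≢? d′))

-- For concrete f and g the implicit argument normalises to ⊤ and is filled in automatically.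
distinct : (f g : Dir → Dir) {_ : True (all? λ d → f d ≢? g d)} → ∀ d → f d ≢ g d
distinct f g {t} = toWitness t

ClawPair : Dir → Dir → Dir → Set
ClawPair o d d′ = d ≢ o × d′ ≢ o × d ≢ d′

claw-pair? : ∀ o d d′ → Dec (ClawPair o d d′)
claw-pair? o d d′ = d ≢? o ×-dec d′ ≢? o ×-dec d ≢? d′

-- Opaque: unfolding these exhaustive checks where they are used makes type checking very slow.
opaque
  claw-pairs-meet : ∀ o a a′ c c′ → ClawPair o a a′ → ClawPair o c c′ →
    (a ≡ c ⊎ a ≡ c′) ⊎ (a′ ≡ c ⊎ a′ ≡ c′)
  claw-pairs-meet = from-yes
    (all? λ o → all? λ a → all? λ a′ → all? λ c → all? λ c′ →
      claw-pair? o a a′ →-dec (claw-pair? o c c′ →-dec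
        ((a ≟ c ⊎-dec a ≟ c′) ⊎-dec (a′ ≟ c ⊎-dec a′ ≟ c′))))

  claw-third : ∀ o d d′ → Σ Dir λ t → t ≢ o × t ≢ d × t ≢ d′
  claw-third = from-yes
    (all? λ o → all? λ d → all? λ d′ → any? λ t → t ≢? o ×-dec t ≢? d ×-dec t ≢? d′)

  claw-pair-or-third : ∀ o d d′ t e e′ → ClawPair o d d′ → t ≢ o → t ≢ d → t ≢ d′ →
    ClawPair o e e′ → SamePair (e , e′) (d , d′) ⊎ (e ≡ t ⊎ e′ ≡ t)
  claw-pair-or-third = from-yes
    (all? λ o → all? λ d → all? λ d′ → all? λ t → all? λ e → all? λ e′ →
      claw-pair? o d d′ →-dec (t ≢? o →-dec (t ≢? d →-dec (t ≢? d′ →-dec (claw-pair? o e e′ →-dec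
        (((e ≟ d ×-dec e′ ≟ d′) ⊎-dec (e ≟ d′ ×-dec e′ ≟ d)) ⊎-dec (e ≟ t ⊎-dec e′ ≟ t)))))))

-- Steps and rays in the grid

X Y : Point → ℤ
X = proj₁
Y = proj₂

Δx Δy : Dir → ℤ
Δx E = 1ℤ
Δx W = - 1ℤ
Δx _ = 0ℤ
Δy N = 1ℤ
Δy S = - 1ℤ
Δy _ = 0ℤ

step-by-offset : ∀ p d → step p d ≡ (X p + Δx d , Y p + Δy d)
step-by-offset (x , y) N = cong (_, y + 1ℤ) (sym (ℤ.+-identityʳ x))
step-by-offset (x , y) S = cong (_, y - 1ℤ) (sym (ℤ.+-identityʳ x))
step-by-offset (x , y) E = cong (x + 1ℤ ,_) (sym (ℤ.+-identityʳ y))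
step-by-offset (x , y) W = cong (x - 1ℤ ,_) (sym (ℤ.+-identityʳ y))

offset-injective : ∀ d d′ → Δx d ≡ Δx d′ → Δy d ≡ Δy d′ → d ≡ d′
offset-injective = from-yes
  (all? λ d → all? λ d′ → Δx d ℤ.≟ Δx d′ →-dec (Δy d ℤ.≟ Δy d′ →-dec d ≟ d′))

offset-nonzero : ∀ d → Δx d ≡ 0ℤ → Δy d ≢ 0ℤ
offset-nonzero = from-yes (all? λ d → Δx d ℤ.≟ 0ℤ →-dec ¬? (Δy d ℤ.≟ 0ℤ))

offset-axis : ∀ d → Δx d ≡ 0ℤ ⊎ Δy d ≡ 0ℤ
offset-axis = from-yes (all? λ d → Δx d ℤ.≟ 0ℤ ⊎-dec Δy d ℤ.≟ 0ℤ)

step-injective : ∀ p d d′ → step p d ≡ step p d′ → d ≡ d′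
step-injective p d d′ eq =
  offset-injective d d′ (∙-cancelˡ (X p) _ _ (cong X eq′)) (∙-cancelˡ (Y p) _ _ (cong Y eq′))
  where
  eq′ : (X p + Δx d , Y p + Δy d) ≡ (X p + Δx d′ , Y p + Δy d′)
  eq′ = trans (sym (step-by-offset p d)) (trans eq (step-by-offset p d′))

step-≢ : ∀ p d → step p d ≢ p
step-≢ p d eq = offset-nonzero d (identityʳ-unique (X p) _ (cong X eq′)) (identityʳ-unique (Y p) _ (cong Y eq′))
  where
  eq′ : (X p + Δx d , Y p + Δy d) ≡ p
  eq′ = trans (sym (step-by-offset p d)) eq

step-axis : ∀ p d → X (step p d) ≡ X p ⊎ Y (step p d) ≡ Y p
step-axis p d with offset-axis d
... | inj₁ Δx≡0 = inj₁ (trans (cong X (step-by-offset p d)) (trans (cong (X p +_) Δx≡0) (ℤ.+-identityʳ (X p))))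
... | inj₂ Δy≡0 = inj₂ (trans (cong Y (step-by-offset p d)) (trans (cong (Y p +_) Δy≡0) (ℤ.+-identityʳ (Y p))))

+-inverse-cancel : ∀ i j → i + j + - j ≡ i
+-inverse-cancel i j = trans (ℤ.+-assoc i j (- j)) (trans (cong (i +_) (ℤ.+-inverseʳ j)) (ℤ.+-identityʳ i))

step-opp : ∀ p d → step (step p d) (opp d) ≡ p
step-opp (x , y) N = cong (x ,_) (+-inverse-cancel y 1ℤ)
step-opp (x , y) S = cong (x ,_) (+-inverse-cancel y (- 1ℤ))
step-opp (x , y) E = cong (_, y) (+-inverse-cancel x 1ℤ)
step-opp (x , y) W = cong (_, y) (+-inverse-cancel x (- 1ℤ))

step-back : ∀ {p q} d → q ≡ step p d → p ≡ step q (opp d)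
step-back {p} d refl = sym (step-opp p d)

Ray : Point → Dir → Point → Set
Ray o N p = X p ≡ X o × Y o ≤ Y p
Ray o S p = X p ≡ X o × Y p ≤ Y o
Ray o E p = Y p ≡ Y o × X o ≤ X p
Ray o W p = Y p ≡ Y o × X p ≤ X o

ray-start : ∀ o d → Ray o d o
ray-start o N = refl , ℤ.≤-refl
ray-start o S = refl , ℤ.≤-refl
ray-start o E = refl , ℤ.≤-refl
ray-start o W = refl , ℤ.≤-refl

ray-step : ∀ {o p} d → Ray o d p → Ray o d (step p d)
ray-step N (eq , le) = eq , ℤ.≤-trans le (ℤ.i≤i+j _ 1ℤ)
ray-step S (eq , le) = eq , ℤ.≤-trans (ℤ.i≤j⇒i-k≤j 1ℤ ℤ.≤-refl) le
ray-step E (eq , le) = eq , ℤ.≤-trans le (ℤ.i≤i+j _ 1ℤ)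
ray-step W (eq , le) = eq , ℤ.≤-trans (ℤ.i≤j⇒i-k≤j 1ℤ ℤ.≤-refl) le

ray-cross : ∀ {o p} d → Ray o d p → X p ≡ X o ⊎ Y p ≡ Y o
ray-cross N (eq , _) = inj₁ eq
ray-cross S (eq , _) = inj₁ eq
ray-cross E (eq , _) = inj₂ eq
ray-cross W (eq , _) = inj₂ eq

ray-meet : ∀ {o p} d d′ → d ≢ d′ → Ray o d p → Ray o d′ p → p ≡ o
ray-meet N N d≢d′ _ _ = ⊥-elim (d≢d′ refl)
ray-meet S S d≢d′ _ _ = ⊥-elim (d≢d′ refl)
ray-meet E E d≢d′ _ _ = ⊥-elim (d≢d′ refl)
ray-meet W W d≢d′ _ _ = ⊥-elim (d≢d′ refl)
ray-meet N S _ (x≡ , le) (_ , ge) = cong₂ _,_ x≡ (ℤ.≤-antisym ge le)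
ray-meet S N _ (x≡ , ge) (_ , le) = cong₂ _,_ x≡ (ℤ.≤-antisym ge le)
ray-meet E W _ (y≡ , le) (_ , ge) = cong₂ _,_ (ℤ.≤-antisym ge le) y≡
ray-meet W E _ (y≡ , ge) (_ , le) = cong₂ _,_ (ℤ.≤-antisym ge le) y≡
ray-meet N E _ (x≡ , _) (y≡ , _) = cong₂ _,_ x≡ y≡
ray-meet N W _ (x≡ , _) (y≡ , _) = cong₂ _,_ x≡ y≡
ray-meet S E _ (x≡ , _) (y≡ , _) = cong₂ _,_ x≡ y≡
ray-meet S W _ (x≡ , _) (y≡ , _) = cong₂ _,_ x≡ y≡
ray-meet E N _ (y≡ , _) (x≡ , _) = cong₂ _,_ x≡ y≡
ray-meet E S _ (y≡ , _) (x≡ , _) = cong₂ _,_ x≡ y≡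
ray-meet W N _ (y≡ , _) (x≡ , _) = cong₂ _,_ x≡ y≡
ray-meet W S _ (y≡ , _) (x≡ , _) = cong₂ _,_ x≡ y≡

consec-∈ˡ : ∀ {L p q} → Consec L p q → p ∈ₗ L
consec-∈ˡ here = here refl
consec-∈ˡ (there c) = there (consec-∈ˡ c)

consec-∈ʳ : ∀ {L p q} → Consec L p q → q ∈ₗ L
consec-∈ʳ here = there (here refl)
consec-∈ʳ (there c) = there (consec-∈ʳ c)

consec-∈ʳ-tail : ∀ {r L p q} → Consec (r ∷ L) p q → q ∈ₗ L
consec-∈ʳ-tail here = here refl
consec-∈ʳ-tail (there c) = consec-∈ʳ c

consec-pred-unique : ∀ {L x y b} → Unique L → Consec L x b → Consec L y b → x ≡ y
consec-pred-unique u here here = refl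
consec-pred-unique (_ ∷ u) here (there c) = ⊥-elim (Unique[x∷xs]⇒x∉xs u (consec-∈ʳ-tail c))
consec-pred-unique (_ ∷ u) (there c) here = ⊥-elim (Unique[x∷xs]⇒x∉xs u (consec-∈ʳ-tail c))
consec-pred-unique (_ ∷ u) (there c) (there c′) = consec-pred-unique u c c′

consec-succ-unique : ∀ {L x y b} → Unique L → Consec L b x → Consec L b y → x ≡ y
consec-succ-unique u here here = refl
consec-succ-unique u here (there c) = ⊥-elim (Unique[x∷xs]⇒x∉xs u (consec-∈ˡ c))
consec-succ-unique u (there c) here = ⊥-elim (Unique[x∷xs]⇒x∉xs u (consec-∈ˡ c))
consec-succ-unique (_ ∷ u) (there c) (there c′) = consec-succ-unique u c c′

consec⇒consec3 : ∀ {L a b c} → Unique L → Consec L a b → Consec L b c → Consec3 L a b c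
consec⇒consec3 u here here = ⊥-elim (Unique[x∷xs]⇒x∉xs u (here refl))
consec⇒consec3 u here (there here) = here
consec⇒consec3 (_ ∷ u) here (there (there c)) = ⊥-elim (Unique[x∷xs]⇒x∉xs u (consec-∈ˡ c))
consec⇒consec3 u (there c) here = ⊥-elim (Unique[x∷xs]⇒x∉xs u (consec-∈ʳ c))
consec⇒consec3 (_ ∷ u) (there c) (there c′) = there (consec⇒consec3 u c c′)

consec3⇒consecˡ : ∀ {L a b c} → Consec3 L a b c → Consec L a b
consec3⇒consecˡ here = here
consec3⇒consecˡ (there t) = there (consec3⇒consecˡ t)

consec3⇒consecʳ : ∀ {L a b c} → Consec3 L a b c → Consec L b c
consec3⇒consecʳ here = there here
consec3⇒consecʳ (there t) = there (consec3⇒consecʳ t)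

consec-++⁺ˡ : ∀ {L p q} R → Consec L p q → Consec (L ++ R) p q
consec-++⁺ˡ R here = here
consec-++⁺ˡ R (there c) = there (consec-++⁺ˡ R c)

consec-++⁺ʳ : ∀ L {R p q} → Consec R p q → Consec (L ++ R) p q
consec-++⁺ʳ [] c = c
consec-++⁺ʳ (_ ∷ L) c = there (consec-++⁺ʳ L c)

consec3-++⁺ˡ : ∀ {L a b c} R → Consec3 L a b c → Consec3 (L ++ R) a b c
consec3-++⁺ˡ R here = here
consec3-++⁺ˡ R (there t) = there (consec3-++⁺ˡ R t)

consec3-++⁺ʳ : ∀ L {R a b c} → Consec3 R a b c → Consec3 (L ++ R) a b c
consec3-++⁺ʳ [] t = t
consec3-++⁺ʳ (_ ∷ L) t = there (consec3-++⁺ʳ L t)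

consec3-split : ∀ {L a b c} → Consec3 L a b c → ∃₂ λ M suf → L ≡ (M ++ [ a ]) ++ b ∷ c ∷ suf
consec3-split here = [] , _ , refl
consec3-split {r ∷ _} (there t) with consec3-split t
... | M , suf , refl = r ∷ M , suf , refl

consec-last : ∀ M {a c} → Consec ((M ++ [ a ]) ++ [ c ]) a c
consec-last [] = here
consec-last (_ ∷ M) = there (consec-last M)

consec-init-∈ : ∀ M {c p q} → Consec (M ++ [ c ]) p q → p ∈ₗ M
consec-init-∈ [] (there ())
consec-init-∈ (_ ∷ []) here = here refl
consec-init-∈ (_ ∷ _ ∷ _) here = here refl
consec-init-∈ (_ ∷ []) (there (there ()))
consec-init-∈ (_ ∷ M@(_ ∷ _)) (there c) = there (consec-init-∈ M c)

unique-middle : ∀ M {c : Point} {R} → Unique (M ++ c ∷ R) → ¬ c ∈ₗ M × ¬ c ∈ₗ R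
unique-middle [] u = (λ ()) , Unique[x∷xs]⇒x∉xs u
unique-middle (y ∷ M) {c} {R} (y∉ ∷ u) =
  (λ { (here y≡c) → All.lookup y∉ (∈-++⁺ʳ M (here refl)) (sym y≡c)
     ; (there c∈M) → proj₁ (unique-middle M u) c∈M })
  , proj₂ (unique-middle M u)

-- Paths with at most one bend

B₁Path : List Point → Set
B₁Path P = IsGridPath P × AtMostOneBend P

Steps : List Point → Set
Steps L = ∀ p q → Consec L p q → ∃[ d ] q ≡ step p d

Straight : List Point → Dir → Set
Straight L δ = ∀ p q → Consec L p q → q ≡ step p δ

straight-or-bends : ∀ L → Steps L → (∃[ y ] BendsAt L y) ⊎ (∃[ δ ] Straight L δ)
straight-or-bends [] _ = inj₂ (N , λ _ _ ())
straight-or-bends (p ∷ []) _ = inj₂ (N , λ { _ _ (there ()) })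
straight-or-bends (p ∷ q ∷ L) steps
  with steps p q here | straight-or-bends (q ∷ L) (λ x y c → steps x y (there c))
... | _ | inj₁ (y , a , e , δ₁ , δ₂ , t , bend) = inj₁ (y , a , e , δ₁ , δ₂ , there t , bend)
... | d , q≡ | inj₂ (δ , straight) with L | d ≟ δ
...   | [] | _ = inj₂ (d , λ { _ _ here → q≡ ; _ _ (there (there ())) })
...   | _ ∷ _ | yes refl = inj₂ (d , λ { _ _ here → q≡ ; x y (there c) → straight x y c })
...   | r ∷ _ | no d≢δ = inj₁ (q , p , r , d , δ , here , q≡ , straight q r here , d≢δ)

straight-on-ray : ∀ {o h} L δ → Ray o δ h → Straight (h ∷ L) δ → ∀ x → x ∈ₗ h ∷ L → Ray o δ x
straight-on-ray L δ ray _ _ (here refl) = ray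
straight-on-ray (h′ ∷ L) δ ray straight x (there x∈) =
  straight-on-ray L δ (subst (Ray _ δ) (sym (straight _ h′ here)) (ray-step δ ray))
    (λ p q c → straight p q (there c)) x x∈

straight-on-ray-back : ∀ M {c} δ → Straight (M ++ [ c ]) δ → ∀ x → x ∈ₗ M ++ [ c ] → Ray c (opp δ) x
straight-on-ray-back [] {c} δ _ _ (here refl) = ray-start c (opp δ)
straight-on-ray-back (y ∷ []) {c} δ straight _ (here refl) =
  subst (Ray c (opp δ)) (sym (step-back δ (straight y c here))) (ray-step (opp δ) (ray-start c (opp δ)))
straight-on-ray-back (y ∷ M@(z ∷ _)) {c} δ straight _ (here refl) =
  subst (Ray c (opp δ)) (sym (step-back δ (straight y z here)))
    (ray-step (opp δ) (straight-on-ray-back M δ (λ p q k → straight p q (there k)) z (here refl)))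
straight-on-ray-back (_ ∷ M) δ straight x (there x∈) =
  straight-on-ray-back M δ (λ p q c → straight p q (there c)) x x∈

-- The parts before and after the bend are straight, since a bend in either would be a second bend.
bend-on-rays : ∀ {P a c e δ₁ δ₂} → B₁Path P →
  Consec3 P a c e → c ≡ step a δ₁ → e ≡ step c δ₂ → δ₁ ≢ δ₂ →
  ∀ x → x ∈ₗ P → Ray c (opp δ₁) x ⊎ Ray c δ₂ x
bend-on-rays {a = a} {c} {e} {δ₁} {δ₂} ((_ , u , steps) , one-bend) t c≡ e≡ δ₁≢δ₂ x x∈
  with consec3-split t
... | M , suf , refl with ∈-++⁻ (M ++ [ a ]) x∈
...   | inj₁ x∈M = inj₁ (straight-on-ray-back (M ++ [ a ]) δ₁ prefix-straight x (∈-++⁺ˡ x∈M))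
  where
  Mₐ : List Point
  Mₐ = M ++ [ a ]
  reassoc : (Mₐ ++ [ c ]) ++ e ∷ suf ≡ Mₐ ++ c ∷ e ∷ suf
  reassoc = ++-assoc Mₐ [ c ] (e ∷ suf)
  prefix-straight : Straight (Mₐ ++ [ c ]) δ₁
  prefix-straight with straight-or-bends (Mₐ ++ [ c ])
                         (λ p q k → steps p q (subst (λ L → Consec L p q) reassoc (consec-++⁺ˡ (e ∷ suf) k)))
  ... | inj₁ (y , a′ , e′ , d₁ , d₂ , t′ , bend′) =
    ⊥-elim (proj₁ (unique-middle Mₐ u)
      (subst (_∈ₗ Mₐ)
        (one-bend y c
          (a′ , e′ , d₁ , d₂ , subst (λ L → Consec3 L a′ y e′) reassoc (consec3-++⁺ˡ (e ∷ suf) t′) , bend′)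
          (a , e , δ₁ , δ₂ , t , c≡ , e≡ , δ₁≢δ₂))
        (consec-init-∈ Mₐ (consec3⇒consecʳ t′))))
  ... | inj₂ (δ , straight) =
    subst (Straight _) (step-injective a δ δ₁ (trans (sym (straight a c (consec-last M))) c≡)) straight
...   | inj₂ x∈suf = inj₂ (straight-on-ray (e ∷ suf) δ₂ (ray-start c δ₂) suffix-straight x x∈suf)
  where
  suffix-straight : Straight (c ∷ e ∷ suf) δ₂
  suffix-straight with straight-or-bends (c ∷ e ∷ suf) (λ p q k → steps p q (consec-++⁺ʳ (M ++ [ a ]) k))
  ... | inj₁ (y , a′ , e′ , d₁ , d₂ , t′ , bend′) =
    ⊥-elim (proj₂ (unique-middle (M ++ [ a ]) u)
      (subst (_∈ₗ e ∷ suf)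
        (one-bend y c
          (a′ , e′ , d₁ , d₂ , consec3-++⁺ʳ (M ++ [ a ]) t′ , bend′)
          (a , e , δ₁ , δ₂ , t , c≡ , e≡ , δ₁≢δ₂))
        (consec-∈ʳ-tail (consec3⇒consecˡ t′))))
  ... | inj₂ (δ , straight) =
    subst (Straight _) (step-injective c δ δ₂ (trans (sym (straight c e here)) e≡)) straight

-- Paths through the 4-star at a point

edge-∈ : ∀ {L p q} → ContainsEdge L p q → p ∈ₗ L × q ∈ₗ L
edge-∈ (inj₁ k) = consec-∈ˡ k , consec-∈ʳ k
edge-∈ (inj₂ k) = consec-∈ʳ k , consec-∈ˡ k

passes-through : ∀ {P b d d′} → Unique P → CoversStar P b d → CoversStar P b d′ → d ≢ d′ →
  ∃₂ λ a e → Consec3 P a b e × (a ≡ step b d × e ≡ step b d′ ⊎ a ≡ step b d′ × e ≡ step b d)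
passes-through {b = b} {d} {d′} u (inj₁ k) (inj₁ k′) d≢d′ =
  ⊥-elim (d≢d′ (step-injective b d d′ (consec-succ-unique u k k′)))
passes-through u (inj₁ k) (inj₂ k′) _ = _ , _ , consec⇒consec3 u k′ k , inj₂ (refl , refl)
passes-through u (inj₂ k) (inj₁ k′) _ = _ , _ , consec⇒consec3 u k k′ , inj₁ (refl , refl)
passes-through {b = b} {d} {d′} u (inj₂ k) (inj₂ k′) d≢d′ =
  ⊥-elim (d≢d′ (step-injective b d d′ (consec-pred-unique u k k′)))

consec3-neighbour : ∀ {P a b e x} → Unique P → Consec3 P a b e → ContainsEdge P b x → x ≡ a ⊎ x ≡ e
consec3-neighbour u t (inj₁ k) = inj₂ (consec-succ-unique u k (consec3⇒consecʳ t))
consec3-neighbour u t (inj₂ k) = inj₁ (consec-pred-unique u k (consec3⇒consecˡ t))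

covers-at-most-two : ∀ {P b d d′ d″} → Unique P → CoversStar P b d → CoversStar P b d′ → d ≢ d′ →
  CoversStar P b d″ → d″ ≡ d ⊎ d″ ≡ d′
covers-at-most-two {b = b} {d} {d′} {d″} u cd cd′ d≢d′ cd″ with passes-through u cd cd′ d≢d′
... | a , e , t , ends with consec3-neighbour u t cd″ | ends
... | inj₁ eq | inj₁ (a≡ , _) = inj₁ (step-injective b d″ d (trans eq a≡))
... | inj₁ eq | inj₂ (a≡ , _) = inj₂ (step-injective b d″ d′ (trans eq a≡))
... | inj₂ eq | inj₁ (_ , e≡) = inj₂ (step-injective b d″ d′ (trans eq e≡))
... | inj₂ eq | inj₂ (_ , e≡) = inj₁ (step-injective b d″ d (trans eq e≡))

CommonStarEdge : List Point → List Point → Point → Set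
CommonStarEdge P Q b = ∃[ d ] (CoversStar P b d × CoversStar Q b d)

star-pairs-disjoint : ∀ {P Q b d₁ d₂ e₁ e₂} → Unique P → Unique Q →
  CoversStar P b d₁ → CoversStar P b d₂ → d₁ ≢ d₂ → CoversStar Q b e₁ → CoversStar Q b e₂ → e₁ ≢ e₂ →
  d₁ ≢ e₁ → d₁ ≢ e₂ → d₂ ≢ e₁ → d₂ ≢ e₂ → ¬ CommonStarEdge P Q b
star-pairs-disjoint uP uQ c₁ c₂ d₁≢d₂ k₁ k₂ e₁≢e₂ n₁₁ n₁₂ n₂₁ n₂₂ (x , cP , cQ)
  with covers-at-most-two uP c₁ c₂ d₁≢d₂ cP | covers-at-most-two uQ k₁ k₂ e₁≢e₂ cQ
... | inj₁ refl | inj₁ eq = n₁₁ eq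
... | inj₁ refl | inj₂ eq = n₁₂ eq
... | inj₂ refl | inj₁ eq = n₂₁ eq
... | inj₂ refl | inj₂ eq = n₂₂ eq

covers-third-≢ : ∀ {P Q b d₁ d₂ d₃} → Unique P → CoversStar P b d₁ → CoversStar P b d₂ → d₁ ≢ d₂ →
  CoversStar Q b d₃ → d₃ ≢ d₁ → d₃ ≢ d₂ → P ≢ Q
covers-third-≢ u c₁ c₂ d₁≢d₂ c₃ d₃≢d₁ d₃≢d₂ refl =
  [ d₃≢d₁ , d₃≢d₂ ]′ (covers-at-most-two u c₁ c₂ d₁≢d₂ c₃)

corner-bends : ∀ {P b d d′} → Unique P → CoversStar P b d → CoversStar P b d′ → Perpendicular d d′ →
  BendsAt P b
corner-bends {b = b} {d} {d′} u cd cd′ (d′≢d , d′≢opp) with passes-through u cd cd′ (d′≢d ∘ sym)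
... | a , e , t , inj₁ (a≡ , e≡) = a , e , opp d , d′ , t , step-back d a≡ , e≡ , d′≢opp ∘ sym
... | a , e , t , inj₂ (a≡ , e≡) = a , e , opp d′ , d , t , step-back d′ a≡ , e≡ ,
  λ eq → d′≢opp (trans (sym (opp-involutive d′)) (cong opp eq))

step-toward : ∀ {a b δ} d → b ≡ step a δ → a ≡ step b d → δ ≡ opp d
step-toward {b = b} {δ} d b≡ refl = step-injective (step b d) δ (opp d) (trans (sym b≡) (sym (step-opp b d)))

straight-through-¬bends : ∀ {P b d} → Unique P → CoversStar P b d → CoversStar P b (opp d) → ¬ BendsAt P b
straight-through-¬bends {P} {b} {d} u cd cd′ (_ , _ , δ₁ , δ₂ , t′ , b≡ , e≡ , δ₁≢δ₂)
  with passes-through u cd cd′ (distinct id opp d)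
... | a , e , t , ends
  with consec-pred-unique u (consec3⇒consecˡ t′) (consec3⇒consecˡ t)
     | consec-succ-unique u (consec3⇒consecʳ t′) (consec3⇒consecʳ t)
... | refl | refl with ends
...   | inj₁ (a≡ , e≡′) =
  δ₁≢δ₂ (trans (step-toward d b≡ a≡) (step-injective b (opp d) δ₂ (trans (sym e≡′) e≡)))
...   | inj₂ (a≡ , e≡′) =
  δ₁≢δ₂ (trans (trans (step-toward (opp d) b≡ a≡) (opp-involutive d))
               (step-injective b d δ₂ (trans (sym e≡′) e≡)))

-- Paths sharing no grid edge

shares-no-edge : ∀ {P Q} (Z : Point → Set) → Steps P → (∀ z → z ∈ₗ P → z ∈ₗ Q → Z z) →
  (∀ p d → Z p → ¬ Z (step p d)) → ¬ SharesEdge P Q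
shares-no-edge Z steps common isolated (p , q , inj₁ k , inQ) with steps p q k
... | d , refl =
  isolated p d (common p (consec-∈ˡ k) (proj₁ (edge-∈ inQ))) (common q (consec-∈ʳ k) (proj₂ (edge-∈ inQ)))
shares-no-edge Z steps common isolated (p , q , inj₂ k , inQ) with steps q p k
... | d , refl =
  isolated q d (common q (consec-∈ˡ k) (proj₂ (edge-∈ inQ))) (common p (consec-∈ʳ k) (proj₁ (edge-∈ inQ)))

bent-on-rays : ∀ {P b} → B₁Path P → BendsAt P b →
  ∃₂ λ d d′ → CoversStar P b d × CoversStar P b d′ × (∀ x → x ∈ₗ P → Ray b d x ⊎ Ray b d′ x)
bent-on-rays b₁P (a , e , δ₁ , δ₂ , t , b≡ , e≡ , δ₁≢δ₂) =
  opp δ₁ , δ₂ ,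
  inj₂ (subst (λ z → Consec _ z _) (step-back δ₁ b≡) (consec3⇒consecˡ t)) ,
  inj₁ (subst (Consec _ _) e≡ (consec3⇒consecʳ t)) ,
  bend-on-rays b₁P t b≡ e≡ δ₁≢δ₂

bent-paths-share-no-edge : ∀ {P Q b} → B₁Path P → B₁Path Q → BendsAt P b → BendsAt Q b →
  ¬ CommonStarEdge P Q b → ¬ SharesEdge P Q
bent-paths-share-no-edge {P} {Q} {b} b₁P b₁Q bendP bendQ disjoint =
  shares-no-edge (_≡ b) (proj₂ (proj₂ (proj₁ b₁P))) meet-at-b
    (λ p d p≡b q≡b → step-≢ p d (trans q≡b (sym p≡b)))
  where
  meet-at-b : ∀ z → z ∈ₗ P → z ∈ₗ Q → z ≡ b
  meet-at-b z z∈P z∈Q with bent-on-rays b₁P bendP | bent-on-rays b₁Q bendQ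
  ... | d , d′ , cd , cd′ , raysP | w , w′ , cw , cw′ , raysQ with raysP z z∈P | raysQ z z∈Q
  ... | inj₁ r | inj₁ r′ = ray-meet d w (λ { refl → disjoint (d , cd , cw) }) r r′
  ... | inj₁ r | inj₂ r′ = ray-meet d w′ (λ { refl → disjoint (d , cd , cw′) }) r r′
  ... | inj₂ r | inj₁ r′ = ray-meet d′ w (λ { refl → disjoint (d′ , cd′ , cw) }) r r′
  ... | inj₂ r | inj₂ r′ = ray-meet d′ w′ (λ { refl → disjoint (d′ , cd′ , cw′) }) r r′

-- The corner is the bend, or the first point of a straight path.
cross-corner : ∀ {P} → B₁Path P →
  ∃[ y ] ((∀ x → x ∈ₗ P → X x ≡ X y ⊎ Y x ≡ Y y) × (∀ {a e} → Consec3 P a y e → BendsAt P y))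
cross-corner {[]} ((() , _) , _)
cross-corner {h ∷ L} b₁P@((_ , u , steps) , _) with straight-or-bends (h ∷ L) steps
... | inj₁ (y , bend) with bent-on-rays b₁P bend
...   | d , d′ , _ , _ , rays = y , (λ x x∈ → [ ray-cross d , ray-cross d′ ]′ (rays x x∈)) , λ _ → bend
cross-corner {h ∷ L} b₁P@((_ , u , steps) , _) | inj₂ (δ , straight) =
  h , (λ x x∈ → ray-cross δ (straight-on-ray L δ (ray-start h δ) straight x x∈)) ,
  λ t → ⊥-elim (Unique[x∷xs]⇒x∉xs u (consec-∈ʳ-tail (consec3⇒consecˡ t)))

vertical-through : ∀ {P b} → B₁Path P → CoversStar P b N → CoversStar P b S →
  ∃[ k ] (k ≢ Y b × ∀ x → x ∈ₗ P → X x ≡ X b ⊎ Y x ≡ k)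
vertical-through {P} {b} b₁P@((_ , u , _) , _) cN cS with cross-corner b₁P
... | y , on-cross , interior-bends = Y y , Yy≢Yb , λ x x∈ → map₁ (λ eq → trans eq Xy≡Xb) (on-cross x x∈)
  where
  Xy≡Xb : X y ≡ X b
  Xy≡Xb with on-cross (step b N) (proj₂ (edge-∈ cN)) | on-cross (step b S) (proj₂ (edge-∈ cS))
  ... | inj₁ eq | _ = sym eq
  ... | inj₂ _ | inj₁ eq = sym eq
  ... | inj₂ eq | inj₂ eq′ with step-injective b N S (cong (X b ,_) (trans eq (sym eq′)))
  ... | ()
  Yy≢Yb : Y y ≢ Y b
  Yy≢Yb eq with cong₂ _,_ Xy≡Xb eq | passes-through {d = N} {S} u cN cS (λ ())
  ... | refl | _ , _ , t , _ = straight-through-¬bends {d = N} u cN cS (interior-bends t)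

horizontal-through : ∀ {P b} → B₁Path P → CoversStar P b E → CoversStar P b W →
  ∃[ j ] (j ≢ X b × ∀ x → x ∈ₗ P → Y x ≡ Y b ⊎ X x ≡ j)
horizontal-through {P} {b} b₁P@((_ , u , _) , _) cE cW with cross-corner b₁P
... | y , on-cross , interior-bends = X y , Xy≢Xb , λ x x∈ → swap (map₂ (λ eq → trans eq Yy≡Yb) (on-cross x x∈))
  where
  Yy≡Yb : Y y ≡ Y b
  Yy≡Yb with on-cross (step b E) (proj₂ (edge-∈ cE)) | on-cross (step b W) (proj₂ (edge-∈ cW))
  ... | inj₂ eq | _ = sym eq
  ... | inj₁ _ | inj₂ eq = sym eq
  ... | inj₁ eq | inj₁ eq′ with step-injective b E W (cong (_, Y b) (trans eq (sym eq′)))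
  ... | ()
  Xy≢Xb : X y ≢ X b
  Xy≢Xb eq with cong₂ _,_ eq Yy≡Yb | passes-through {d = E} {W} u cE cW (λ ())
  ... | refl | _ , _ , t , _ = straight-through-¬bends {d = E} u cE cW (interior-bends t)

-- The common points are b and the crossing (j , k) of the two other lines, which is not a neighbour of b.
crossing-paths-share-no-edge : ∀ {P Q b} → B₁Path P → B₁Path Q →
  CoversStar P b N → CoversStar P b S → CoversStar Q b E → CoversStar Q b W → ¬ SharesEdge P Q
crossing-paths-share-no-edge {P} {Q} {b} b₁P b₁Q cN cS cE cW
  with vertical-through b₁P cN cS | horizontal-through b₁Q cE cW
... | k , k≢ , onP | j , j≢ , onQ = shares-no-edge Z (proj₂ (proj₂ (proj₁ b₁P))) common isolated
  where
  Z : Point → Set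
  Z z = z ≡ b ⊎ z ≡ (j , k)
  common : ∀ z → z ∈ₗ P → z ∈ₗ Q → Z z
  common z z∈P z∈Q with onP z z∈P | onQ z z∈Q
  ... | inj₁ x≡ | inj₁ y≡ = inj₁ (cong₂ _,_ x≡ y≡)
  ... | inj₁ x≡ | inj₂ x≡j = ⊥-elim (j≢ (trans (sym x≡j) x≡))
  ... | inj₂ y≡k | inj₁ y≡ = ⊥-elim (k≢ (trans (sym y≡k) y≡))
  ... | inj₂ y≡k | inj₂ x≡j = inj₂ (cong₂ _,_ x≡j y≡k)
  isolated : ∀ p d → Z p → ¬ Z (step p d)
  isolated p d (inj₁ refl) (inj₁ eq) = step-≢ p d eq
  isolated p d (inj₂ refl) (inj₂ eq) = step-≢ p d eq
  isolated p d (inj₁ refl) (inj₂ eq) =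
    [ (λ x≡ → j≢ (trans (sym (cong X eq)) x≡)) , (λ y≡ → k≢ (trans (sym (cong Y eq)) y≡)) ]′ (step-axis p d)
  isolated p d (inj₂ refl) (inj₁ eq) =
    [ (λ x≡ → j≢ (trans (sym x≡) (cong X eq))) , (λ y≡ → k≢ (trans (sym y≡) (cong Y eq))) ]′ (step-axis p d)

shares-edge-sym : ∀ {P Q} → SharesEdge P Q → SharesEdge Q P
shares-edge-sym (p , q , inP , inQ) = p , q , inQ , inP

perpendicular-straight-paths-share-no-edge : ∀ {P Q b} d →
  B₁Path P → B₁Path Q →
  CoversStar P b d → CoversStar P b (opp d) → CoversStar Q b (rot d) → CoversStar Q b (opp (rot d)) →
  ¬ SharesEdge P Q
perpendicular-straight-paths-share-no-edge N b₁P b₁Q c₁ c₂ c₃ c₄ =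
  crossing-paths-share-no-edge b₁P b₁Q c₁ c₂ c₃ c₄
perpendicular-straight-paths-share-no-edge S b₁P b₁Q c₁ c₂ c₃ c₄ =
  crossing-paths-share-no-edge b₁P b₁Q c₂ c₁ c₄ c₃
perpendicular-straight-paths-share-no-edge E b₁P b₁Q c₁ c₂ c₃ c₄ =
  crossing-paths-share-no-edge b₁Q b₁P c₄ c₃ c₁ c₂ ∘ shares-edge-sym
perpendicular-straight-paths-share-no-edge W b₁P b₁Q c₁ c₂ c₃ c₄ =
  crossing-paths-share-no-edge b₁Q b₁P c₃ c₄ c₂ c₁ ∘ shares-edge-sym

-- Pies

same-pair? : ∀ p q → Dec (SamePair p q)
same-pair? (a , a′) (c , c′) = (a ≟ c ×-dec a′ ≟ c′) ⊎-dec (a ≟ c′ ×-dec a′ ≟ c)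

corner-pairs : Fin 4 → Dir × Dir
corner-pairs = lookup ((N , E) ∷ (E , S) ∷ (S , W) ∷ (W , N) ∷ [])

cross-pairs : Dir → Fin 4 → Dir × Dir
cross-pairs d = lookup ((d , opp d) ∷ (rot d , opp (rot d)) ∷ (d , rot d) ∷ (opp d , opp (rot d)) ∷ [])

PairsDistinct : (Fin 4 → Dir × Dir) → Set
PairsDistinct pr = ∀ i j → i ≢ j → ¬ SamePair (pr i) (pr j)

pairs-distinct? : ∀ pr → Dec (PairsDistinct pr)
pairs-distinct? pr = Fin.all? λ i → Fin.all? λ j → ¬? (i Fin.≟ j) →-dec ¬? (same-pair? (pr i) (pr j))

corner-pairs-perpendicular : ∀ i → Perpendicular (proj₁ (corner-pairs i)) (proj₂ (corner-pairs i))
corner-pairs-perpendicular =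
  from-yes (Fin.all? λ i → perpendicular? (proj₁ (corner-pairs i)) (proj₂ (corner-pairs i)))

corner-pairs-distinct : PairsDistinct corner-pairs
corner-pairs-distinct = from-yes (pairs-distinct? corner-pairs)

cross-pairs-proper : ∀ d i → proj₁ (cross-pairs d i) ≢ proj₂ (cross-pairs d i)
cross-pairs-proper = from-yes (all? λ d → Fin.all? λ i → proj₁ (cross-pairs d i) ≢? proj₂ (cross-pairs d i))

cross-pairs-distinct : ∀ d → PairsDistinct (cross-pairs d)
cross-pairs-distinct = from-yes (all? λ d → pairs-distinct? (cross-pairs d))

module _ {n} (P : Fin n → List Point) (M : Fin n → Set) (b : Point) where

  Covered : Dir × Dir → Set
  Covered (d , d′) = ∃[ v ] (M v × CoversStar (P v) b d × CoversStar (P v) b d′)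

  -- For M = (_∈ A) this is FormsClaw P A (claw b o), unfolded.
  ClawCovered : Dir → Set
  ClawCovered o = ∀ d d′ → d ≢ o → d′ ≢ o → d ≢ d′ → Covered (d , d′)

  PieCovered : (Fin 4 → Dir × Dir) → Set
  PieCovered pr = ∀ i → Covered (pr i)

  covered : ∀ {o} → ClawCovered o → ∀ d d′ {_ : True (claw-pair? o d d′)} → Covered (d , d′)
  covered f d d′ {t} = let (d≢o , d′≢o , d≢d′) = toWitness t in f d d′ d≢o d′≢o d≢d′

  pie : ∀ {pr} → Covered (pr zero) → Covered (pr (suc zero)) → Covered (pr (suc (suc zero))) →
    Covered (pr (suc (suc (suc zero)))) → PieCovered pr
  pie c₀ _ _ _ zero = c₀
  pie _ c₁ _ _ (suc zero) = c₁
  pie _ _ c₂ _ (suc (suc zero)) = c₂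
  pie _ _ _ c₃ (suc (suc (suc zero))) = c₃

  two-claws-pie : ∀ o₁ o₂ → o₁ ≢ o₂ → ClawCovered o₁ → ClawCovered o₂ →
    PieCovered corner-pairs ⊎ ∃[ d ] PieCovered (cross-pairs d)
  two-claws-pie N N o₁≢o₂ _ _ = ⊥-elim (o₁≢o₂ refl)
  two-claws-pie E E o₁≢o₂ _ _ = ⊥-elim (o₁≢o₂ refl)
  two-claws-pie S S o₁≢o₂ _ _ = ⊥-elim (o₁≢o₂ refl)
  two-claws-pie W W o₁≢o₂ _ _ = ⊥-elim (o₁≢o₂ refl)
  two-claws-pie N S _ f g = inj₁ (pie (covered g N E) (covered f E S) (covered f S W) (covered g W N))
  two-claws-pie S N _ f g = inj₁ (pie (covered f N E) (covered g E S) (covered g S W) (covered f W N))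
  two-claws-pie E W _ f g = inj₁ (pie (covered g N E) (covered g E S) (covered f S W) (covered f W N))
  two-claws-pie W E _ f g = inj₁ (pie (covered f N E) (covered f E S) (covered g S W) (covered g W N))
  two-claws-pie N E _ f g = inj₂ (E , pie (covered f E W) (covered g S N) (covered f E S) (covered g W N))
  two-claws-pie E N _ f g = inj₂ (E , pie (covered g E W) (covered f S N) (covered g E S) (covered f W N))
  two-claws-pie E S _ f g = inj₂ (S , pie (covered f S N) (covered g W E) (covered f S W) (covered g N E))
  two-claws-pie S E _ f g = inj₂ (S , pie (covered g S N) (covered f W E) (covered g S W) (covered f N E))
  two-claws-pie S W _ f g = inj₂ (W , pie (covered f W E) (covered g N S) (covered f W N) (covered g E S))
  two-claws-pie W S _ f g = inj₂ (W , pie (covered g W E) (covered f N S) (covered g W N) (covered f E S))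
  two-claws-pie W N _ f g = inj₂ (N , pie (covered f N S) (covered g E W) (covered f N E) (covered g S W))
  two-claws-pie N W _ f g = inj₂ (N , pie (covered g N S) (covered f E W) (covered g N E) (covered f S W))

pie-config : ∀ {n} {P : Fin n → List Point} {A : Subset n} {b} pr → (∀ i → proj₁ (pr i) ≢ proj₂ (pr i)) →
  PairsDistinct pr → (cov : PieCovered P (_∈ A) b pr) → PieConfig P A b (proj₁ ∘ cov) pr
pie-config pr proper pairs-distinct cov =
  proj₁ ∘ proj₂ ∘ cov , (λ i → proper i , proj₂ (proj₂ (cov i))) , pairs-distinct

true-pie : ∀ {n} {P : Fin n → List Point} {A b} → (∀ v → Unique (P v)) →
  PieCovered P (_∈ A) b corner-pairs → TruePie P A b
true-pie {P = P} {b = b} u cov =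
  proj₁ ∘ cov , corner-pairs , pie-config corner-pairs proper corner-pairs-distinct cov , bends
  where
  proper : ∀ i → proj₁ (corner-pairs i) ≢ proj₂ (corner-pairs i)
  proper i = ≢-sym (proj₁ (corner-pairs-perpendicular i))
  bends : ∀ i → BendsAt (P (proj₁ (cov i))) b
  bends i = let (v , _ , c , c′) = cov i in corner-bends (u v) c c′ (corner-pairs-perpendicular i)

false-pie : ∀ {n} {P : Fin n → List Point} {A b} → (∀ v → Unique (P v)) →
  ∀ d → PieCovered P (_∈ A) b (cross-pairs d) → FalsePie P A b
false-pie {P = P} {b = b} u d cov =
  proj₁ ∘ cov , cross-pairs d , two , three ,
  pie-config (cross-pairs d) (cross-pairs-proper d) (cross-pairs-distinct d) cov , (λ ()) ,
  corner-bends (u _) (proj₁ (ends two)) (proj₂ (ends two)) (distinct rot id d , distinct rot opp d) ,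
  corner-bends (u _) (proj₁ (ends three)) (proj₂ (ends three))
    (distinct (opp ∘ rot) opp d , distinct (opp ∘ rot) (opp ∘ opp) d) ,
  only-two-bend ,
  star-pairs-disjoint (u _) (u _) (proj₁ (ends two)) (proj₂ (ends two)) (distinct id rot d)
    (proj₁ (ends three)) (proj₂ (ends three)) (distinct opp (opp ∘ rot) d)
    (distinct id opp d) (distinct id (opp ∘ rot) d) (distinct rot opp d) (distinct rot (opp ∘ rot) d)
  where
  two three : Fin 4
  two = suc (suc zero)
  three = suc (suc (suc zero))
  ends : ∀ k → CoversStar (P (proj₁ (cov k))) b (proj₁ (cross-pairs d k))
             × CoversStar (P (proj₁ (cov k))) b (proj₂ (cross-pairs d k))
  ends k = proj₂ (proj₂ (cov k))
  only-two-bend : ∀ k → BendsAt (P (proj₁ (cov k))) b → k ≡ two ⊎ k ≡ three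
  only-two-bend zero =
    ⊥-elim ∘ straight-through-¬bends (u _) (proj₁ (ends zero)) (proj₂ (ends zero))
  only-two-bend (suc zero) =
    ⊥-elim ∘ straight-through-¬bends (u _) (proj₁ (ends (suc zero))) (proj₂ (ends (suc zero)))
  only-two-bend (suc (suc zero)) _ = inj₁ refl
  only-two-bend (suc (suc (suc zero))) _ = inj₂ refl

two-claws-form-pie : ∀ {n} {P : Fin n → List Point} {A : Subset n} {b} → (∀ v → Unique (P v)) →
  ∀ o₁ o₂ → o₁ ≢ o₂ → FormsClaw P A (claw b o₁) → FormsClaw P A (claw b o₂) →
  TruePie P A b ⊎ FalsePie P A b
two-claws-form-pie {P = P} {A} {b} u o₁ o₂ o₁≢o₂ f g with two-claws-pie P (_∈ A) b o₁ o₂ o₁≢o₂ f g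
... | inj₁ cov = inj₁ (true-pie u cov)
... | inj₂ (d , cov) = inj₂ (false-pie u d cov)

-- Induced 4-cycles and claw-cliques

cyc-adj? : ∀ i j → Dec (CycAdj 0 i j)
cyc-adj? i j = (ℕ.suc (toℕ i) ℕ.% 4 ℕ.≟ toℕ j) ⊎-dec (ℕ.suc (toℕ j) ℕ.% 4 ℕ.≟ toℕ i)

induced-4-cycle : ∀ {n} (G : SimpleGraph n) {w₀ w₁ w₂ w₃} →
  Adj G w₀ w₁ → Adj G w₁ w₂ → Adj G w₂ w₃ → Adj G w₃ w₀ → ¬ Adj G w₀ w₂ → ¬ Adj G w₁ w₃ →
  w₀ ≢ w₂ → w₁ ≢ w₃ → InducedCycle G 0
induced-4-cycle G {w₀} {w₁} {w₂} {w₃} a₀₁ a₁₂ a₂₃ a₃₀ ¬a₀₂ ¬a₁₃ w₀≢w₂ w₁≢w₃ =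
  w , injective , adjacency
  where
  w : Fin 4 → Fin _
  w = lookup (w₀ ∷ w₁ ∷ w₂ ∷ w₃ ∷ [])
  adj⇒≢ : ∀ {u v} → Adj G u v → u ≢ v
  adj⇒≢ a refl = irrefl G a
  injective : ∀ {i j} → w i ≡ w j → i ≡ j
  injective {zero} {zero} _ = refl
  injective {zero} {suc zero} eq = ⊥-elim (adj⇒≢ a₀₁ eq)
  injective {zero} {suc (suc zero)} eq = ⊥-elim (w₀≢w₂ eq)
  injective {zero} {suc (suc (suc zero))} eq = ⊥-elim (adj⇒≢ a₃₀ (sym eq))
  injective {suc zero} {zero} eq = ⊥-elim (adj⇒≢ a₀₁ (sym eq))
  injective {suc zero} {suc zero} _ = refl
  injective {suc zero} {suc (suc zero)} eq = ⊥-elim (adj⇒≢ a₁₂ eq)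
  injective {suc zero} {suc (suc (suc zero))} eq = ⊥-elim (w₁≢w₃ eq)
  injective {suc (suc zero)} {zero} eq = ⊥-elim (w₀≢w₂ (sym eq))
  injective {suc (suc zero)} {suc zero} eq = ⊥-elim (adj⇒≢ a₁₂ (sym eq))
  injective {suc (suc zero)} {suc (suc zero)} _ = refl
  injective {suc (suc zero)} {suc (suc (suc zero))} eq = ⊥-elim (adj⇒≢ a₂₃ eq)
  injective {suc (suc (suc zero))} {zero} eq = ⊥-elim (adj⇒≢ a₃₀ eq)
  injective {suc (suc (suc zero))} {suc zero} eq = ⊥-elim (w₁≢w₃ (sym eq))
  injective {suc (suc (suc zero))} {suc (suc zero)} eq = ⊥-elim (adj⇒≢ a₂₃ (sym eq))
  injective {suc (suc (suc zero))} {suc (suc (suc zero))} _ = refl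
  linked : ∀ {i j} → Adj G (w i) (w j) → {_ : True (cyc-adj? i j)} → Adj G (w i) (w j) ⇔ CycAdj 0 i j
  linked a {c} = mk⇔ (λ _ → toWitness c) (λ _ → a)
  unlinked : ∀ {i j} → ¬ Adj G (w i) (w j) → {_ : False (cyc-adj? i j)} → Adj G (w i) (w j) ⇔ CycAdj 0 i j
  unlinked ¬a {c} = mk⇔ (⊥-elim ∘ ¬a) (⊥-elim ∘ toWitnessFalse c)
  adjacency : ∀ i j → Adj G (w i) (w j) ⇔ CycAdj 0 i j
  adjacency zero zero = unlinked (irrefl G)
  adjacency zero (suc zero) = linked a₀₁
  adjacency zero (suc (suc zero)) = unlinked ¬a₀₂
  adjacency zero (suc (suc (suc zero))) = linked (SimpleGraph.sym G a₃₀)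
  adjacency (suc zero) zero = linked (SimpleGraph.sym G a₀₁)
  adjacency (suc zero) (suc zero) = unlinked (irrefl G)
  adjacency (suc zero) (suc (suc zero)) = linked a₁₂
  adjacency (suc zero) (suc (suc (suc zero))) = unlinked ¬a₁₃
  adjacency (suc (suc zero)) zero = unlinked (¬a₀₂ ∘ SimpleGraph.sym G)
  adjacency (suc (suc zero)) (suc zero) = linked (SimpleGraph.sym G a₁₂)
  adjacency (suc (suc zero)) (suc (suc zero)) = unlinked (irrefl G)
  adjacency (suc (suc zero)) (suc (suc (suc zero))) = linked a₂₃
  adjacency (suc (suc (suc zero))) zero = linked a₃₀
  adjacency (suc (suc (suc zero))) (suc zero) = unlinked (¬a₁₃ ∘ SimpleGraph.sym G)
  adjacency (suc (suc (suc zero))) (suc (suc zero)) = linked (SimpleGraph.sym G a₂₃)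
  adjacency (suc (suc (suc zero))) (suc (suc (suc zero))) = unlinked (irrefl G)

finite-⊎-∀ : ∀ {n} {F : Set} {Q : Fin n → Set} → (∀ v → F ⊎ Q v) → F ⊎ (∀ v → Q v)
finite-⊎-∀ {ℕ.zero} _ = inj₂ λ ()
finite-⊎-∀ {ℕ.suc n} {Q = Q} h with h zero | finite-⊎-∀ {Q = Q ∘ suc} (h ∘ suc)
... | inj₁ f | _ = inj₁ f
... | inj₂ _ | inj₁ f = inj₁ f
... | inj₂ q₀ | inj₂ qs = inj₂ λ { zero → q₀ ; (suc v) → qs v }

module _ {n} {G : SimpleGraph n} (R : B1EPG G) where

  private
    P : Fin n → List Point
    P = path R

    unique : ∀ v → Unique (P v)
    unique v = proj₁ (proj₂ (isPath R v))

    b₁-path : ∀ v → B₁Path (P v)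
    b₁-path v = isPath R v , oneBend R v

  star-neighbours-≢ : ∀ {u v b d₁ d₂ d₃} → CoversStar (P u) b d₁ → CoversStar (P u) b d₂ → d₁ ≢ d₂ →
    CoversStar (P v) b d₃ → d₃ ≢ d₁ → d₃ ≢ d₂ → u ≢ v
  star-neighbours-≢ {u} c₁ c₂ d₁≢d₂ c₃ d₃≢d₁ d₃≢d₂ =
    covers-third-≢ (unique u) c₁ c₂ d₁≢d₂ c₃ d₃≢d₁ d₃≢d₂ ∘ cong P

  ¬shares-edge⇒¬adj : ∀ {u v} → u ≢ v → ¬ SharesEdge (P u) (P v) → ¬ Adj G u v
  ¬shares-edge⇒¬adj u≢v ¬shared = ¬shared ∘ Equivalence.to (edgeRep R _ _ u≢v)

  shared-star-edge-adj : ∀ {u v b} x d y → CoversStar (P u) b x → CoversStar (P u) b d → x ≢ d →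
    CoversStar (P v) b d → CoversStar (P v) b y → y ≢ x → y ≢ d → Adj G u v
  shared-star-edge-adj _ _ _ cx cd x≢d cd′ cy y≢x y≢d =
    Equivalence.from (edgeRep R _ _ (star-neighbours-≢ cx cd x≢d cy y≢x y≢d)) (_ , _ , cd , cd′)

  opposite-corners-¬adj : ∀ {u v b} d d′ → CoversStar (P u) b d → CoversStar (P u) b d′ →
    CoversStar (P v) b (opp d) → CoversStar (P v) b (opp d′) → Perpendicular d d′ → u ≢ v × ¬ Adj G u v
  opposite-corners-¬adj {u} {v} d d′ cd cd′ ce ce′ perp@(d′≢d , d′≢opp)
    with perpendicular-opposites d d′ perp
  ... | perp′ , e≢d , e≢d′ , e′≢d , e′≢d′ =
    u≢v , ¬shares-edge⇒¬adj u≢v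
      (bent-paths-share-no-edge (b₁-path u) (b₁-path v)
        (corner-bends (unique u) cd cd′ perp) (corner-bends (unique v) ce ce′ perp′)
        (star-pairs-disjoint (unique u) (unique v) cd cd′ (≢-sym d′≢d) ce ce′ (≢-sym (proj₁ perp′))
          (≢-sym e≢d) (≢-sym e′≢d) (≢-sym e≢d′) (≢-sym e′≢d′)))
    where
    u≢v : u ≢ v
    u≢v = star-neighbours-≢ cd cd′ (≢-sym d′≢d) ce e≢d e≢d′

  crossing-¬adj : ∀ {u v b} d → CoversStar (P u) b d → CoversStar (P u) b (opp d) →
    CoversStar (P v) b (rot d) → CoversStar (P v) b (opp (rot d)) → u ≢ v × ¬ Adj G u v
  crossing-¬adj {u} {v} d c₁ c₂ c₃ c₄ =
    u≢v , ¬shares-edge⇒¬adj u≢v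
      (perpendicular-straight-paths-share-no-edge d (b₁-path u) (b₁-path v) c₁ c₂ c₃ c₄)
    where
    u≢v : u ≢ v
    u≢v = star-neighbours-≢ c₁ c₂ (distinct id opp d) c₃ (distinct rot id d) (distinct rot opp d)

  corner-pie-cycle : ∀ {M b} → Covered P M b (N , E) → Covered P M b (E , S) →
    Covered P M b (S , W) → Covered P M b (W , N) → InducedCycle G 0
  corner-pie-cycle (v₀ , _ , n₀ , e₀) (v₁ , _ , e₁ , s₁) (v₂ , _ , s₂ , w₂) (v₃ , _ , w₃ , n₃) =
    induced-4-cycle G
      (shared-star-edge-adj N E S n₀ e₀ (λ ()) e₁ s₁ (λ ()) (λ ()))
      (shared-star-edge-adj E S W e₁ s₁ (λ ()) s₂ w₂ (λ ()) (λ ()))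
      (shared-star-edge-adj S W N s₂ w₂ (λ ()) w₃ n₃ (λ ()) (λ ()))
      (shared-star-edge-adj W N E w₃ n₃ (λ ()) n₀ e₀ (λ ()) (λ ()))
      (proj₂ diagonal₀₂) (proj₂ diagonal₁₃) (proj₁ diagonal₀₂) (proj₁ diagonal₁₃)
    where
    diagonal₀₂ : v₀ ≢ v₂ × ¬ Adj G v₀ v₂
    diagonal₀₂ = opposite-corners-¬adj N E n₀ e₀ s₂ w₂ ((λ ()) , (λ ()))
    diagonal₁₃ : v₁ ≢ v₃ × ¬ Adj G v₁ v₃
    diagonal₁₃ = opposite-corners-¬adj E S e₁ s₁ w₃ n₃ ((λ ()) , (λ ()))

  cross-pie-cycle : ∀ {M b} d → Covered P M b (d , opp d) → Covered P M b (rot d , opp (rot d)) →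
    Covered P M b (d , rot d) → Covered P M b (opp d , opp (rot d)) → InducedCycle G 0
  cross-pie-cycle d (vA , _ , aᵈ , aᵒ) (vB , _ , bʳ , bᵒ) (vC , _ , cᵈ , cʳ) (vD , _ , dᵒ , dʳ) =
    induced-4-cycle G
      (shared-star-edge-adj (opp d) d (rot d) aᵒ aᵈ (distinct opp id d) cᵈ cʳ
        (distinct rot opp d) (distinct rot id d))
      (shared-star-edge-adj d (rot d) (opp (rot d)) cᵈ cʳ (distinct id rot d) bʳ bᵒ
        (distinct (opp ∘ rot) id d) (distinct (opp ∘ rot) rot d))
      (shared-star-edge-adj (rot d) (opp (rot d)) (opp d) bʳ bᵒ (distinct rot (opp ∘ rot) d) dʳ dᵒ
        (distinct opp rot d) (distinct opp (opp ∘ rot) d))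
      (shared-star-edge-adj (opp (rot d)) (opp d) d dʳ dᵒ (distinct (opp ∘ rot) opp d) aᵒ aᵈ
        (distinct id (opp ∘ rot) d) (distinct id opp d))
      (proj₂ straight-diagonal) (proj₂ corner-diagonal) (proj₁ straight-diagonal) (proj₁ corner-diagonal)
    where
    straight-diagonal : vA ≢ vB × ¬ Adj G vA vB
    straight-diagonal = crossing-¬adj d aᵈ aᵒ bʳ bᵒ
    corner-diagonal : vC ≢ vD × ¬ Adj G vC vD
    corner-diagonal = opposite-corners-¬adj d (rot d) cᵈ cʳ dᵒ dʳ (distinct rot id d , distinct rot opp d)

  pie-cycle : ∀ {M b} → PieCovered P M b corner-pairs ⊎ ∃[ d ] PieCovered P M b (cross-pairs d) →
    InducedCycle G 0
  pie-cycle (inj₁ cov) =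
    corner-pie-cycle (cov zero) (cov (suc zero)) (cov (suc (suc zero))) (cov (suc (suc (suc zero))))
  pie-cycle (inj₂ (d , cov)) =
    cross-pie-cycle d (cov zero) (cov (suc zero)) (cov (suc (suc zero))) (cov (suc (suc (suc zero))))

  claw-clique-⊆ : ∀ {K₁ K₂ b o} → RepresentedOn R K₁ (claw b o) → RepresentedOn R K₂ (claw b o) →
    MaximalClique G K₂ → K₁ ⊆ K₂
  claw-clique-⊆ {K₁} {K₂} {b} {o} (_ , _ , on₁) (_ , _ , on₂) (_ , maximal) {x} x∈K₁ =
    maximal x λ u u∈K₂ u≢x → Equivalence.from (edgeRep R u x u≢x) (shared u u∈K₂)
    where
    shared : ∀ u → u ∈ K₂ → SharesEdge (P u) (P x)
    shared u u∈K₂ with on₂ u u∈K₂ | on₁ x x∈K₁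
    ... | a , a′ , a≢o , a′≢o , a≢a′ , ca , ca′ , _ | c , c′ , c≢o , c′≢o , c≢c′ , cc , cc′ , _
      with claw-pairs-meet o a a′ c c′ (a≢o , a′≢o , a≢a′) (c≢o , c′≢o , c≢c′)
    ... | inj₁ (inj₁ refl) = b , _ , ca , cc
    ... | inj₁ (inj₂ refl) = b , _ , ca , cc′
    ... | inj₂ (inj₁ refl) = b , _ , ca′ , cc
    ... | inj₂ (inj₂ refl) = b , _ , ca′ , cc′

  member-covers-pair-or-third : ∀ {K b o d d′ t} → RepresentedOn R K (claw b o) → ClawPair o d d′ →
    t ≢ o → t ≢ d → t ≢ d′ → ∀ v → Covered P (_∈ K) b (d , d′) ⊎ (v ∈ K → CoversStar (P v) b t)
  member-covers-pair-or-third {K} {o = o} {d} {d′} {t} (_ , _ , on) pair t≢o t≢d t≢d′ v with v ∈? K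
  ... | no v∉K = inj₂ (⊥-elim ∘ v∉K)
  ... | yes v∈K with on v v∈K
  ... | e , e′ , e≢o , e′≢o , e≢e′ , ce , ce′ , _
    with claw-pair-or-third o d d′ t e e′ pair t≢o t≢d t≢d′ (e≢o , e′≢o , e≢e′)
  ... | inj₁ (inj₁ (refl , refl)) = inj₁ (v , v∈K , ce , ce′)
  ... | inj₁ (inj₂ (refl , refl)) = inj₁ (v , v∈K , ce′ , ce)
  ... | inj₂ (inj₁ refl) = inj₂ (λ _ → ce)
  ... | inj₂ (inj₂ refl) = inj₂ (λ _ → ce′)

  claw-clique-forms-claw : ∀ {K b o} → RepresentedOn R K (claw b o) → FormsClaw P K (claw b o)
  claw-clique-forms-claw {b = b} {o} r d d′ d≢o d′≢o d≢d′ with claw-third o d d′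
  ... | t , t≢o , t≢d , t≢d′ =
    [ id , (λ all-cover-t → ⊥-elim (proj₁ (proj₂ r) (b , t , all-cover-t))) ]′
      (finite-⊎-∀ (member-covers-pair-or-third r (d≢o , d′≢o , d≢d′) t≢o t≢d t≢d′))

  claw-cliques-apart : Chordal G → ∀ {K₁ K₂} → MaximalClique G K₁ → MaximalClique G K₂ → K₁ ≢ K₂ →
    ∀ {C₁ C₂} → RepresentedOn R K₁ C₁ → RepresentedOn R K₂ C₂ → center C₁ ≢ center C₂
  claw-cliques-apart chordal max₁ max₂ K₁≢K₂ {claw b o₁} {claw .b o₂} r₁ r₂ refl with o₁ ≟ o₂
  ... | yes refl = K₁≢K₂ (⊆-antisym (claw-clique-⊆ r₁ r₂ max₂) (claw-clique-⊆ r₂ r₁ max₁))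
  ... | no o₁≢o₂ =
    chordal 0 (pie-cycle (two-claws-pie P (λ _ → ⊤) b o₁ o₂ o₁≢o₂
      (claw-covered-by-all (claw-clique-forms-claw r₁)) (claw-covered-by-all (claw-clique-forms-claw r₂))))
    where
    claw-covered-by-all : ∀ {K o} → FormsClaw P K (claw b o) → ClawCovered P (λ _ → ⊤) b o
    claw-covered-by-all f d d′ d≢o d′≢o d≢d′ =
      let (v , _ , cd , cd′) = f d d′ d≢o d′≢o d≢d′ in v , tt , cd , cd′

lemma4 :
    (∀ {n} (G : SimpleGraph n) (R : B1EPG G) (S : Subset n) b o₁ o₂ →
       o₁ ≢ o₂ →
       FormsClaw (path R) S (claw b o₁) → FormsClaw (path R) S (claw b o₂) →
       TruePie (path R) S b ⊎ FalsePie (path R) S b)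
    ×
    (∀ {n} (G : SimpleGraph n) (R : B1EPG G) → Chordal G →
       ∀ (K₁ K₂ : Subset n) → MaximalClique G K₁ → MaximalClique G K₂ →
       K₁ ≢ K₂ → ∀ C₁ C₂ → RepresentedOn R K₁ C₁ → RepresentedOn R K₂ C₂ →
       center C₁ ≡ center C₂ → ⊥)
lemma4 =
  (λ G R S b o₁ o₂ → two-claws-form-pie (λ v → proj₁ (proj₂ (isPath R v))) o₁ o₂) ,
  (λ G R chordal K₁ K₂ max₁ max₂ K₁≢K₂ C₁ C₂ → claw-cliques-apart R chordal max₁ max₂ K₁≢K₂)
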